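{- Let $G$ be a graph, $r$ a positive integer, $L_S=(s_1,\dots,s_n)$ a subordering of $S\subseteq V(G)$, $v\in V(G)\setminus S$ and $s\in S$. Then $s\notin \mathrm{bp}(G,L_S,v)$ if and only if for all $u\in V(G)$, \[\mathrm{Wreach}_r(G,\mathrm{placebefore}(L_S,s,v),u)=\mathrm{Wreach}_r(G,\mathrm{placeafter}(L_S,s,v),u).\]
   Context: All graphs are finite, simple and undirected. The length of a path is its number of edges (a single vertex is a path of length $0$). A subordering $L_S$ of a graph $G$ is a linear ordering of a subset $S\subseteq V(G)$; we write $u\preceq_{L_S} w$ if $u=w$ or $u$ precedes $w$ in $L_S$. Given a subordering $L_S$ and vertices $u,x\in V(G)$, we say $u\in \mathrm{Wreach}_r(G,L_S,x)$ if either $u=x$, or $u\in S$ and there is a path $P$ between $u$ and $x$ of length at most $r$ such that $u\preceq_{L_S} w$ for all $w\in V(P)\cap S$. For $L_S=(s_1,\dots,s_n)$ and $v\notin S$: $\mathrm{placeafter}(L_S,s_i,v)=(s_1,\dots,s_i,v,s_{i+1},\dots,s_n)$ and $\mathrm{placebefore}(L_S,s_i,v)=(s_1,\dots,s_{i-1},v,s_i,\dots,s_n)$. A vertex $s\in S$ is a breakpoint of $v$ if $\mathrm{Wreach}_r(G,\mathrm{placebefore}(L_S,s,v),v)\ne \mathrm{Wreach}_r(G,\mathrm{placeafter}(L_S,s,v),v)$; $\mathrm{bp}(G,L_S,v)\subseteq S$ denotes the set of breakpoints of $v$. -}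

module Defs where

open import Data.Nat using (ℕ; _≤_)
open import Data.Fin using (Fin; _≟_)
open import Data.List using (List; []; _∷_; length; last)
open import Data.Maybe using (just)
open import Data.List.Membership.Propositional using (_∈_; _∉_)
open import Data.List.Relation.Unary.Linked using (Linked)
open import Data.List.Relation.Unary.Unique.Propositional using (Unique)
open import Data.Product using (Σ; _×_; ∃)
open import Data.Sum using (_⊎_)
open import Relation.Nullary using (¬_; yes; no)
open import Relation.Binary.PropositionalEquality using (_≡_)
open import Function.Bundles using (_⇔_)

record Graph : Set₁ where
  field
    n     : ℕ
    Adj   : Fin n → Fin n → Set
    sym   : ∀ {x y} → Adj x y → Adj y x
    irr   : ∀ {x} → ¬ Adj x x

open Graph public

V : Graph → Set
V G = Fin (n G)

-- A subordering: a duplicate-free list of vertices; S is its set of entries.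
record Subordering (G : Graph) : Set where
  constructor subordering
  field
    order  : List (V G)
    unique : Unique order

open Subordering public

data Precedes {A : Set} : List A → A → A → Set where
  here  : ∀ {u w xs} → w ∈ xs → Precedes (u ∷ xs) u w
  there : ∀ {u w y xs} → Precedes xs u w → Precedes (y ∷ xs) u w

_⪯[_]_ : {A : Set} → A → List A → A → Set
u ⪯[ L ] w = (u ≡ w) ⊎ Precedes L u w

record PathLe (G : Graph) (r : ℕ) (u x : V G) : Set where
  field
    rest    : List (V G)
    linked  : Linked (Adj G) (u ∷ rest)
    distinct : Unique (u ∷ rest)
    ends    : last (u ∷ rest) ≡ just x
    short   : length rest ≤ r

open PathLe public

-- u ∈ Wreach_r(G, L, x)
Wreach : (G : Graph) (r : ℕ) (L : List (V G)) (x u : V G) → Set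
Wreach G r L x u =
  (u ≡ x) ⊎
  (u ∈ L × Σ (PathLe G r u x) (λ P → ∀ w → w ∈ (u ∷ rest P) → w ∈ L → u ⪯[ L ] w))

_≐_ : {A : Set} → (A → Set) → (A → Set) → Set
P ≐ Q = ∀ a → P a ⇔ Q a

placeBefore : {k : ℕ} → List (Fin k) → Fin k → Fin k → List (Fin k)
placeBefore [] s v = []
placeBefore (x ∷ xs) s v with x ≟ s
... | yes _ = v ∷ x ∷ xs
... | no  _ = x ∷ placeBefore xs s v

placeAfter : {k : ℕ} → List (Fin k) → Fin k → Fin k → List (Fin k)
placeAfter [] s v = []
placeAfter (x ∷ xs) s v with x ≟ s
... | yes _ = x ∷ v ∷ xs
... | no  _ = x ∷ placeAfter xs s v

IsBreakpoint : (G : Graph) (r : ℕ) (L : Subordering G) (v s : V G) → Set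
IsBreakpoint G r L v s =
  s ∈ order L ×
  ¬ (Wreach G r (placeBefore (order L) s v) v ≐ Wreach G r (placeAfter (order L) s v) v)

-- Placing v just before or just after s yields orders that differ only in the
-- relative position of the adjacent pair v, s. A weak-reachability witness can
-- only be lost by this swap if it starts at one of the two and its path passes
-- through the other; the initial segment of that path up to the other vertex
-- (reversed, when it starts at v) then shows s ∈ Wreach_r(v) in the order where s
-- precedes v. That is impossible when s is not a breakpoint, because s is never
-- in Wreach_r(v) when v precedes s.
module Submission where

open import Defs
open import Data.Nat using (ℕ; _≥_; _≤_; z≤n; s≤s)
open import Data.Nat.Properties using (≤-trans; ≤-reflexive; suc-injective)
open import Data.Fin using (Fin; _≟_)
open import Data.List using (List; []; _∷_; _++_; length; last; [_])
open import Data.Maybe using (just)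
open import Data.Maybe.Relation.Binary.Connected using (Connected; just)
open import Data.List.Membership.Propositional using (_∈_; _∉_)
open import Data.List.Membership.Propositional.Properties using (∈-++⁺ˡ; ∈-++⁺ʳ)
open import Data.List.Relation.Binary.Subset.Propositional using (_⊆_)
open import Data.List.Relation.Binary.Permutation.Propositional using (_↭_; ↭-refl; ↭-sym; ↭-trans; ↭-prep; ↭⇒↭ₛ)
open import Data.List.Relation.Binary.Permutation.Propositional.Properties using (∷↭∷ʳ; ↭-length; ∈-resp-↭)
open import Data.List.Relation.Binary.Permutation.Setoid.Properties using (Unique-resp-↭)
open import Data.List.Relation.Unary.Any using (here; there)
open import Data.List.Relation.Unary.All using ([]; _∷_) renaming (tabulate to tabulateAll; lookup to lookupAll)
open import Data.List.Relation.Unary.AllPairs using ([]; _∷_)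
open import Data.List.Relation.Unary.Linked using (Linked; [-]; _∷_)
open import Data.List.Relation.Unary.Linked.Properties using (++⁺)
open import Data.List.Relation.Unary.Unique.Propositional using (Unique)
open import Data.Product using (Σ; ∃; ∃₂; _×_; _,_)
open import Data.Sum using (_⊎_; inj₁; inj₂; [_,_]′; map₁; map₂)
open import Data.Empty using (⊥-elim)
open import Function using (_∘_)
open import Function.Bundles using (_⇔_; mk⇔; Equivalence)
open import Relation.Nullary using (¬_; yes; no)
open import Relation.Binary.Definitions using (DecidableEquality)
open import Relation.Binary.PropositionalEquality
  using (_≡_; _≢_; refl; cong; subst; setoid)
  renaming (sym to ≡-sym)

module _ {A : Set} where

  ∈-swap : ∀ (pre : List A) {a b post w} → w ∈ pre ++ a ∷ b ∷ post → w ∈ pre ++ b ∷ a ∷ post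
  ∈-swap []        (here w≡a)         = there (here w≡a)
  ∈-swap []        (there (here w≡b)) = here w≡b
  ∈-swap []        (there (there w∈)) = there (there w∈)
  ∈-swap (x ∷ pre) (here w≡x)         = here w≡x
  ∈-swap (x ∷ pre) (there w∈)         = there (∈-swap pre w∈)

  last⇒∈ : ∀ (xs : List A) {x} → last xs ≡ just x → x ∈ xs
  last⇒∈ (y ∷ [])     refl = here refl
  last⇒∈ (y ∷ z ∷ xs) eq   = there (last⇒∈ (z ∷ xs) eq)

  last-∷ʳ : ∀ (xs : List A) x → last (xs ++ [ x ]) ≡ just x
  last-∷ʳ []           x = refl
  last-∷ʳ (y ∷ [])     x = refl
  last-∷ʳ (y ∷ z ∷ xs) x = last-∷ʳ (z ∷ xs) x

  Precedes⇒∈ˡ : ∀ {xs : List A} {u w} → Precedes xs u w → u ∈ xs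
  Precedes⇒∈ˡ (here _)  = here refl
  Precedes⇒∈ˡ (there p) = there (Precedes⇒∈ˡ p)

  Precedes⇒∈ʳ : ∀ {xs : List A} {u w} → Precedes xs u w → w ∈ xs
  Precedes⇒∈ʳ (here w∈) = there w∈
  Precedes⇒∈ʳ (there p) = there (Precedes⇒∈ʳ p)

  Precedes-++⁺ʳ : ∀ (pre : List A) {ys u w} → Precedes ys u w → Precedes (pre ++ ys) u w
  Precedes-++⁺ʳ []        p = p
  Precedes-++⁺ʳ (x ∷ pre) p = there (Precedes-++⁺ʳ pre p)

  Precedes-++⁻ʳ : ∀ (pre : List A) {ys u w} → u ∉ pre → Precedes (pre ++ ys) u w → Precedes ys u w
  Precedes-++⁻ʳ []        u∉ p         = p
  Precedes-++⁻ʳ (x ∷ pre) u∉ (here _)  = ⊥-elim (u∉ (here refl))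
  Precedes-++⁻ʳ (x ∷ pre) u∉ (there p) = Precedes-++⁻ʳ pre (u∉ ∘ there) p

  Precedes-swap : ∀ (pre : List A) {a b post u w} → Precedes (pre ++ a ∷ b ∷ post) u w →
                  (u ≡ a × w ≡ b) ⊎ Precedes (pre ++ b ∷ a ∷ post) u w
  Precedes-swap []        (here (here w≡b)) = inj₁ (refl , w≡b)
  Precedes-swap []        (here (there w∈)) = inj₂ (there (here w∈))
  Precedes-swap []        (there (here w∈)) = inj₂ (here (there w∈))
  Precedes-swap []        (there (there p)) = inj₂ (there (there p))
  Precedes-swap (x ∷ pre) (here w∈)         = inj₂ (here (∈-swap pre w∈))
  Precedes-swap (x ∷ pre) (there p)         = map₂ there (Precedes-swap pre p)

  Precedes-swap-successor : ∀ (pre : List A) {a b post w} → a ∉ pre → a ∉ post →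
                            Precedes (pre ++ a ∷ b ∷ post) a w →
                            w ≡ b ⊎ Precedes (pre ++ b ∷ a ∷ post) b w
  Precedes-swap-successor pre a∉pre a∉post p with Precedes-++⁻ʳ pre a∉pre p
  ... | here (here w≡b)     = inj₁ w≡b
  ... | here (there w∈post) = inj₂ (Precedes-++⁺ʳ pre (here (there w∈post)))
  ... | there (here w∈post) = inj₂ (Precedes-++⁺ʳ pre (here (there w∈post)))
  ... | there (there q)     = ⊥-elim (a∉post (Precedes⇒∈ˡ q))

  adjacent-¬Precedes : ∀ (pre : List A) {a b post} → b ∉ pre → a ∉ post → a ≢ b →
                       ¬ Precedes (pre ++ a ∷ b ∷ post) b a
  adjacent-¬Precedes pre b∉pre a∉post a≢b p with Precedes-++⁻ʳ pre b∉pre p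
  ... | here _              = a≢b refl
  ... | there (here a∈post) = a∉post a∈post
  ... | there (there q)     = a∉post (Precedes⇒∈ʳ q)

  first-occurrence : DecidableEquality A → ∀ {s : A} {xs} → s ∈ xs →
                     ∃₂ λ pre post → s ∉ pre × xs ≡ pre ++ s ∷ post
  first-occurrence _≟A_ (here refl) = [] , _ , (λ ()) , refl
  first-occurrence _≟A_ {s} {x ∷ xs} (there s∈xs) with x ≟A s
  ... | yes refl = [] , xs , (λ ()) , refl
  ... | no x≢s with pre , post , s∉pre , refl ← first-occurrence _≟A_ s∈xs =
    x ∷ pre , post , (λ { (here s≡x) → x≢s (≡-sym s≡x) ; (there s∈pre) → s∉pre s∈pre }) , refl

module _ {k : ℕ} where

  placeBefore-split : ∀ (pre : List (Fin k)) {post s} v → s ∉ pre →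
                      placeBefore (pre ++ s ∷ post) s v ≡ pre ++ v ∷ s ∷ post
  placeBefore-split [] {s = s} v s∉pre with s ≟ s
  ... | yes _  = refl
  ... | no s≢s = ⊥-elim (s≢s refl)
  placeBefore-split (x ∷ pre) {s = s} v s∉pre with x ≟ s
  ... | yes refl = ⊥-elim (s∉pre (here refl))
  ... | no _     = cong (x ∷_) (placeBefore-split pre v (s∉pre ∘ there))

  placeAfter-split : ∀ (pre : List (Fin k)) {post s} v → s ∉ pre →
                     placeAfter (pre ++ s ∷ post) s v ≡ pre ++ s ∷ v ∷ post
  placeAfter-split [] {s = s} v s∉pre with s ≟ s
  ... | yes _  = refl
  ... | no s≢s = ⊥-elim (s≢s refl)
  placeAfter-split (x ∷ pre) {s = s} v s∉pre with x ≟ s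
  ... | yes refl = ⊥-elim (s∉pre (here refl))
  ... | no _     = cong (x ∷_) (placeAfter-split pre v (s∉pre ∘ there))

module _ {A : Set} {R : A → A → Set} where

  prefix-ending-at : ∀ {u y} rest → Linked R (u ∷ rest) → Unique (u ∷ rest) → y ∈ u ∷ rest →
                     ∃ λ rest′ → Linked R (u ∷ rest′) × Unique (u ∷ rest′) × last (u ∷ rest′) ≡ just y ×
                                 length rest′ ≤ length rest × u ∷ rest′ ⊆ u ∷ rest
  prefix-ending-at rest l uq (here refl) =
    [] , [-] , ([] ∷ []) , refl , z≤n , λ { (here w≡u) → here w≡u }
  prefix-ending-at (z ∷ rest) (Ruz ∷ l) (u∉ ∷ uq) (there y∈) with prefix-ending-at rest l uq y∈
  ... | rest′ , l′ , uq′ , last≡ , len≤ , ⊆rest =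
    z ∷ rest′ , Ruz ∷ l′ , tabulateAll (lookupAll u∉ ∘ ⊆rest) ∷ uq′ , last≡ , s≤s len≤ ,
    λ { (here w≡u) → here w≡u ; (there w∈) → there (⊆rest w∈) }

  reverse-linked : (∀ {x y} → R x y → R y x) → ∀ {u y} rest → Linked R (u ∷ rest) → last (u ∷ rest) ≡ just y →
                   ∃ λ rest′ → Linked R (y ∷ rest′) × last (y ∷ rest′) ≡ just u × y ∷ rest′ ↭ u ∷ rest
  reverse-linked R-sym []         [-]         refl = [] , [-] , refl , ↭-refl
  reverse-linked R-sym {u} {y} (z ∷ rest) (Ruz ∷ l) last≡ with reverse-linked R-sym rest l last≡
  ... | rest′ , l′ , last≡′ , p =
    rest′ ++ [ u ] ,
    ++⁺ l′ (subst (λ m → Connected R m (just u)) (≡-sym last≡′) (just (R-sym Ruz))) [-] ,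
    last-∷ʳ (y ∷ rest′) u ,
    ↭-trans (↭-sym (∷↭∷ʳ u (y ∷ rest′))) (↭-prep u p)

module _ {G : Graph} {r : ℕ} where

  PathLe-prefix : ∀ {u x y} (P : PathLe G r u x) → y ∈ u ∷ rest P →
                  Σ (PathLe G r u y) λ Q → u ∷ rest Q ⊆ u ∷ rest P
  PathLe-prefix P y∈P with prefix-ending-at (rest P) (linked P) (distinct P) y∈P
  ... | rest′ , l , uq , last≡ , len≤ , ⊆P =
    record { rest = rest′ ; linked = l ; distinct = uq ; ends = last≡ ; short = ≤-trans len≤ (short P) } , ⊆P

  PathLe-reverse : ∀ {u x} (P : PathLe G r u x) → Σ (PathLe G r x u) λ Q → x ∷ rest Q ↭ u ∷ rest P
  PathLe-reverse P with reverse-linked (sym G) (rest P) (linked P) (ends P)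
  ... | rest′ , l , last≡ , p =
    record { rest = rest′ ; linked = l ; ends = last≡
           ; distinct = Unique-resp-↭ (setoid _) (↭⇒↭ₛ (↭-sym p)) (distinct P)
           ; short = ≤-trans (≤-reflexive (suc-injective (↭-length p))) (short P) } , p

module _ (G : Graph) (r : ℕ) where

  Wreach-along : ∀ {L u x y} (P : PathLe G r u x) → u ∈ L →
                 (∀ w → w ∈ u ∷ rest P → w ∈ L → u ⪯[ L ] w) → y ∈ u ∷ rest P → Wreach G r L y u
  Wreach-along P u∈L minimal y∈P with PathLe-prefix P y∈P
  ... | Q , Q⊆P = inj₂ (u∈L , Q , λ w → minimal w ∘ Q⊆P)

  Wreach-reorder : ∀ {L L′ c d} → (∀ {w} → w ∈ L → w ∈ L′) → (∀ {w} → w ∈ L′ → w ∈ L) →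
                   (∀ {u w} → Precedes L u w → (u ≡ c × w ≡ d) ⊎ Precedes L′ u w) →
                   ¬ Wreach G r L d c → ∀ {x u} → Wreach G r L x u → Wreach G r L′ x u
  Wreach-reorder to from reorder c↛d (inj₁ u≡x) = inj₁ u≡x
  Wreach-reorder {L} {L′} to from reorder c↛d {x} {u} (inj₂ (u∈L , P , minimal)) =
    inj₂ (to u∈L , P , λ w w∈P w∈L′ → minimal′ w∈P (minimal w w∈P (from w∈L′)))
    where
    minimal′ : ∀ {w} → w ∈ u ∷ rest P → u ⪯[ L ] w → u ⪯[ L′ ] w
    minimal′ w∈P (inj₁ u≡w) = inj₁ u≡w
    minimal′ w∈P (inj₂ u≺w) with reorder u≺w
    ... | inj₁ (refl , refl) = ⊥-elim (c↛d (Wreach-along P u∈L minimal w∈P))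
    ... | inj₂ u≺′w          = inj₂ u≺′w

  Wreach-swap-reverse : ∀ (pre : List (V G)) {a b post} → a ∉ pre → a ∉ post →
                        Wreach G r (pre ++ a ∷ b ∷ post) b a → Wreach G r (pre ++ b ∷ a ∷ post) a b
  Wreach-swap-reverse pre a∉pre a∉post (inj₁ a≡b) = inj₁ (≡-sym a≡b)
  Wreach-swap-reverse pre {a} {b} {post} a∉pre a∉post (inj₂ (_ , P , minimal)) with PathLe-reverse P
  ... | Q , Q↭P = inj₂ (∈-++⁺ʳ pre (here refl) , Q , minimalQ)
    where
    minimalQ : ∀ w → w ∈ b ∷ rest Q → w ∈ pre ++ b ∷ a ∷ post → b ⪯[ pre ++ b ∷ a ∷ post ] w
    minimalQ w w∈Q w∈L with minimal w (∈-resp-↭ Q↭P w∈Q) (∈-swap pre w∈L)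
    ... | inj₁ refl = inj₂ (Precedes-++⁺ʳ pre (here (here refl)))
    ... | inj₂ a≺w  = map₁ ≡-sym (Precedes-swap-successor pre a∉pre a∉post a≺w)

  Wreach-swap : ∀ (pre : List (V G)) {a b post} → a ∉ pre → a ∉ post →
                ¬ Wreach G r (pre ++ b ∷ a ∷ post) a b →
                ∀ x → Wreach G r (pre ++ a ∷ b ∷ post) x ≐ Wreach G r (pre ++ b ∷ a ∷ post) x
  Wreach-swap pre a∉pre a∉post b↛a x u = mk⇔
    (Wreach-reorder (∈-swap pre) (∈-swap pre) (Precedes-swap pre)
                    (b↛a ∘ Wreach-swap-reverse pre a∉pre a∉post))
    (Wreach-reorder (∈-swap pre) (∈-swap pre) (Precedes-swap pre) b↛a)

  ¬Wreach-adjacent : ∀ (pre : List (V G)) {a b post} → b ∉ pre → a ∉ post → a ≢ b →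
                     ¬ Wreach G r (pre ++ a ∷ b ∷ post) a b
  ¬Wreach-adjacent pre b∉pre a∉post a≢b (inj₁ b≡a) = a≢b (≡-sym b≡a)
  ¬Wreach-adjacent pre {b = b} b∉pre a∉post a≢b (inj₂ (_ , P , minimal)) =
    [ a≢b ∘ ≡-sym , adjacent-¬Precedes pre b∉pre a∉post a≢b ]′
      (minimal _ (last⇒∈ (b ∷ rest P) (ends P)) (∈-++⁺ʳ pre (here refl)))

  ¬Wreach-placeBefore : ∀ (L : List (V G)) {s v} → s ∈ L → v ∉ L → ¬ Wreach G r (placeBefore L s v) v s
  ¬Wreach-placeBefore L {v = v} s∈L v∉L with pre , post , s∉pre , refl ← first-occurrence _≟_ s∈L
    rewrite placeBefore-split pre {post} v s∉pre =
    ¬Wreach-adjacent pre s∉pre (v∉L ∘ ∈-++⁺ʳ pre ∘ there) λ { refl → v∉L s∈L }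

  Wreach-placeBefore≐placeAfter : ∀ (L : List (V G)) {s v} → s ∈ L → v ∉ L →
                                  ¬ Wreach G r (placeAfter L s v) v s →
                                  ∀ x → Wreach G r (placeBefore L s v) x ≐ Wreach G r (placeAfter L s v) x
  Wreach-placeBefore≐placeAfter L {v = v} s∈L v∉L s↛v
    with pre , post , s∉pre , refl ← first-occurrence _≟_ s∈L
    rewrite placeBefore-split pre {post} v s∉pre | placeAfter-split pre {post} v s∉pre =
    Wreach-swap pre (v∉L ∘ ∈-++⁺ˡ) (v∉L ∘ ∈-++⁺ʳ pre ∘ there) s↛v

lemma7 : (G : Graph) (r : ℕ) → r ≥ 1 → (L : Subordering G) (v s : V G) →
         v ∉ order L → s ∈ order L →
         (¬ IsBreakpoint G r L v s) ⇔
         (∀ u → Wreach G r (placeBefore (order L) s v) u ≐ Wreach G r (placeAfter (order L) s v) u)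
lemma7 G r _ L v s v∉L s∈L = mk⇔ unchanged (λ same (_ , differ) → differ (same v))
  where
  unchanged : ¬ IsBreakpoint G r L v s →
              ∀ u → Wreach G r (placeBefore (order L) s v) u ≐ Wreach G r (placeAfter (order L) s v) u
  unchanged ¬bp = Wreach-placeBefore≐placeAfter G r (order L) s∈L v∉L λ s↝v →
    ¬bp (s∈L , λ same → ¬Wreach-placeBefore G r (order L) s∈L v∉L (Equivalence.from (same s) s↝v))
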